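{- Let $G=(V,E)$ be a directed graph and $G_h=(V_h,E_h)$ a subgraph of $G$. Let $W_h\subseteq V_h$ be such that every $u\in W_h$ has exactly the same incoming edges in $G_h$ as in $G$, and let $B_h=V_h\setminus W_h$; assume $B_h\neq\emptyset$. Let $T\subseteq W_h$ and $v\in V$ be such that $T$ induces an almost top SCC with respect to $v$ in $G$. If either $v\notin B_h$ and $v$ can be reached in $G_h$ from a vertex of $B_h$, or $v\in B_h$ and $|B_h|\ge 2$, then $v$ is a vertex-dominator in the flow graph $G'_h(r_h)$.
   Context: A top SCC (tSCC) is a strongly connected component with no incoming edges from outside it. $T$ induces an almost tSCC with respect to $v$ in $G$ if $G[T]$ is a tSCC of $G\setminus\{v\}$ but $T$ has an incoming edge from $v$ in $G$. The graph $G'_h$ with root $r_h$: if $|B_h|\ge 2$, $G'_h$ is $G_h$ plus a new vertex $r_h$ and an edge from $r_h$ to each vertex of $B_h$; if $|B_h|=1$, $r_h$ is the unique vertex of $B_h$ and $G'_h=G_h$. The flow graph $H(r)$ is $H$ with root $r$ and all vertices unreachable from $r$ removed; a vertex $v\ne r$ is a vertex-dominator in $H(r)$ if some vertex $u\notin\{r,v\}$ reachable from $r$ has every $r$–$u$ path passing through $v$. -}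

module Defs where

open import Data.Nat using (ℕ; _≤_)
open import Data.Fin using (Fin)
open import Data.Fin.Subset using (Subset; _∈_; _∉_; _─_; ∣_∣; Nonempty)
open import Data.Maybe using (Maybe; just; nothing)
open import Data.Product using (Σ; ∃; _×_; _,_)
open import Data.Empty using (⊥)
open import Data.Unit using (⊤)
open import Relation.Binary.PropositionalEquality using (_≡_; _≢_)
open import Relation.Nullary using (¬_)

data Path {A : Set} (E : A → A → Set) : A → A → Set where
  [] : ∀ {x} → Path E x x
  _∷_ : ∀ {x y z} → E x y → Path E y z → Path E x z

data _∈P_ {A : Set} {E : A → A → Set} (w : A) : ∀ {x y} → Path E x y → Set where
  here-end : w ∈P ([] {x = w})
  here     : ∀ {y z} (e : E w y) (p : Path E y z) → w ∈P (e ∷ p)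
  there    : ∀ {x y z} (e : E x y) {p : Path E y z} → w ∈P p → w ∈P (e ∷ p)

Reach : {A : Set} → (A → A → Set) → A → A → Set
Reach E x y = Path E x y

DelV : ∀ {n} → (Fin n → Fin n → Set) → Fin n → (Fin n → Fin n → Set)
DelV E v x y = x ≢ v × y ≢ v × E x y

IsSCC : ∀ {n} → (Fin n → Fin n → Set) → (Fin n → Set) → Subset n → Set
IsSCC E Allowed T =
  Nonempty T ×
  (∀ x → x ∈ T → Allowed x) ×
  (∀ x y → x ∈ T → y ∈ T → Reach E x y) ×
  (∀ x y → x ∈ T → Allowed y → Reach E x y → Reach E y x → y ∈ T)

IsTopSCC : ∀ {n} → (Fin n → Fin n → Set) → (Fin n → Set) → Subset n → Set
IsTopSCC E Allowed T =
  IsSCC E Allowed T ×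
  (∀ x y → Allowed x → x ∉ T → y ∈ T → ¬ E x y)

AlmostTopSCC : ∀ {n} → (Fin n → Fin n → Set) → Subset n → Fin n → Set
AlmostTopSCC E T v =
  IsTopSCC (DelV E v) (λ x → x ≢ v) T ×
  (∃ λ y → y ∈ T × E v y)

-- vertex-dominator in the flow graph H(r): v ≠ r and some u ∉ {r, v}
-- reachable from r has every r–u path passing through v.
-- (Vertices unreachable from r play no role, since all paths considered start at r.)
IsVertexDominator : {A : Set} → (A → A → Set) → A → A → Set
IsVertexDominator E r v =
  v ≢ r ×
  (∃ λ u → u ≢ r × u ≢ v × Reach E r u × (∀ (p : Path E r u) → v ∈P p))

-- G_h' when |B_h| ≥ 2: vertices Maybe (Fin n), nothing = new root r_h,
-- edges of G_h plus r_h → b for every b ∈ B_h.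
ExtEdges : ∀ {n} → (Fin n → Fin n → Set) → Subset n → Maybe (Fin n) → Maybe (Fin n) → Set
ExtEdges Eh B (just x) (just y) = Eh x y
ExtEdges Eh B nothing (just y) = y ∈ B
ExtEdges Eh B _ nothing = ⊥

DominatorInGh' : ∀ {n} → (Fin n → Fin n → Set) → Subset n → Fin n → Set
DominatorInGh' Eh B v =
  (2 ≤ ∣ B ∣ → IsVertexDominator (ExtEdges Eh B) nothing (just v)) ×
  (∀ r → ∣ B ∣ ≡ 1 → r ∈ B → IsVertexDominator Eh r v)

-- T is a top SCC of G ∖ {v}, so every edge of G (hence of G_h) entering T
-- comes from T itself or from v.  Walking backwards along any path into T,
-- the path must therefore either start inside T or visit v.  In G'_h the root
-- lies outside T (its out-neighbours are in B_h, which is disjoint from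
-- T ⊆ W_h), so every path from the root to the out-neighbour y ∈ T of v visits
-- v; the hypotheses of the theorem provide such a path through B_h, v and y.
module Submission where

open import Defs
open import Data.Nat using (ℕ; _≤_; s≤s)
open import Data.Nat.Properties using (suc-injective)
open import Data.Fin using (Fin; suc)
open import Data.Fin.Properties using (_≟_)
open import Data.Fin.Subset using (Subset; _∈_; _∉_; _⊆_; _─_; ∣_∣; Nonempty; inside; outside)
open import Data.Fin.Subset.Properties using (_∈?_)
open import Data.Vec using (_∷_; here; there)
open import Data.Maybe using (just; nothing)
open import Data.Maybe.Relation.Unary.Any using (Any; just)
open import Data.Product using (∃; _×_; _,_)
open import Data.Sum as Sum using (_⊎_; inj₁; inj₂)
open import Data.Empty using (⊥-elim)
open import Function.Base using (id)
open import Function.Bundles using (_⇔_; Equivalence)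
open import Relation.Nullary using (yes; no; ¬_)
open import Relation.Binary.PropositionalEquality using (_≡_; _≢_; refl; cong; subst)

x∈q⇒x∉p─q : ∀ {n} (p q : Subset n) {x} → x ∈ q → x ∉ p ─ q
x∈q⇒x∉p─q (_ ∷ p) (inside  ∷ q) here        ()
x∈q⇒x∉p─q (_ ∷ p) (inside  ∷ q) (there x∈q) (there x∈p─q) = x∈q⇒x∉p─q p q x∈q x∈p─q
x∈q⇒x∉p─q (_ ∷ p) (outside ∷ q) (there x∈q) (there x∈p─q) = x∈q⇒x∉p─q p q x∈q x∈p─q

x∈p⇒∣p∣≢0 : ∀ {n} {p : Subset n} {x} → x ∈ p → ∣ p ∣ ≢ 0
x∈p⇒∣p∣≢0 here ()
x∈p⇒∣p∣≢0 {p = inside  ∷ p} (there x∈p) ()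
x∈p⇒∣p∣≢0 {p = outside ∷ p} (there x∈p) = x∈p⇒∣p∣≢0 x∈p

∣p∣≡1⇒x∈p∧y∈p⇒x≡y : ∀ {n} (p : Subset n) {x y} → ∣ p ∣ ≡ 1 → x ∈ p → y ∈ p → x ≡ y
∣p∣≡1⇒x∈p∧y∈p⇒x≡y (inside  ∷ p) _  here        here        = refl
∣p∣≡1⇒x∈p∧y∈p⇒x≡y (inside  ∷ p) ≡1 here        (there y∈p) = ⊥-elim (x∈p⇒∣p∣≢0 y∈p (suc-injective ≡1))
∣p∣≡1⇒x∈p∧y∈p⇒x≡y (inside  ∷ p) ≡1 (there x∈p) _           = ⊥-elim (x∈p⇒∣p∣≢0 x∈p (suc-injective ≡1))
∣p∣≡1⇒x∈p∧y∈p⇒x≡y (outside ∷ p) ≡1 (there x∈p) (there y∈p) = cong suc (∣p∣≡1⇒x∈p∧y∈p⇒x≡y p ≡1 x∈p y∈p)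

module _ {A : Set} {E : A → A → Set} where

  _++_ : ∀ {x y z} → Path E x y → Path E y z → Path E x z
  []      ++ q = q
  (e ∷ p) ++ q = e ∷ (p ++ q)

  map-Path : ∀ {B : Set} {F : B → B → Set} (f : A → B) → (∀ {x y} → E x y → F (f x) (f y))
           → ∀ {x y} → Path E x y → Path F (f x) (f y)
  map-Path f g []      = []
  map-Path f g (e ∷ p) = g e ∷ map-Path f g p

ClosedExcept : {A : Set} → (A → A → Set) → (A → Set) → A → Set
ClosedExcept E S v = ∀ {x z} → E x z → S z → S x ⊎ x ≡ v

module _ {A : Set} {E : A → A → Set} {S : A → Set} {v : A} (closed : ClosedExcept E S v) where

  closedExcept⇒start∈S⊎v∈P : ∀ {x t} → S t → (p : Path E x t) → S x ⊎ v ∈P p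
  closedExcept⇒start∈S⊎v∈P t∈S [] = inj₁ t∈S
  closedExcept⇒start∈S⊎v∈P t∈S (e ∷ p) with closedExcept⇒start∈S⊎v∈P t∈S p
  ... | inj₂ v∈p = inj₂ (there e v∈p)
  ... | inj₁ z∈S with closed e z∈S
  ...   | inj₁ x∈S  = inj₁ x∈S
  ...   | inj₂ refl = inj₂ (here e p)

  closedExcept⇒isVertexDominator : ∀ {r u} → ¬ S r → S u → v ≢ r → u ≢ v → Reach E r u
                                 → IsVertexDominator E r v
  closedExcept⇒isVertexDominator r∉S u∈S v≢r u≢v r⇝u =
    v≢r , _ , (λ { refl → r∉S u∈S }) , u≢v , r⇝u , visits
    where
    visits : ∀ p → v ∈P p
    visits p with closedExcept⇒start∈S⊎v∈P u∈S p
    ... | inj₁ r∈S  = ⊥-elim (r∉S r∈S)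
    ... | inj₂ v∈p = v∈p

almostTopSCC⇒closedExcept : ∀ {n} {E F : Fin n → Fin n → Set} {T v} → AlmostTopSCC E T v
                          → (∀ x y → F x y → E x y) → ClosedExcept F (_∈ T) v
almostTopSCC⇒closedExcept {T = T} {v} (((_ , allowed , _) , noEntry) , _) F⊆E {x} {z} e z∈T
  with x ∈? T | x ≟ v
... | yes x∈T | _        = inj₁ x∈T
... | no _    | yes x≡v = inj₂ x≡v
... | no x∉T  | no x≢v  = ⊥-elim (noEntry x z x≢v x∉T z∈T (x≢v , allowed z z∈T , F⊆E x z e))

extEdges-closedExcept : ∀ {n} {F : Fin n → Fin n → Set} {B T : Subset n} {v}
                      → ClosedExcept F (_∈ T) v → (∀ {t} → t ∈ T → t ∉ B)
                      → ClosedExcept (ExtEdges F B) (Any (_∈ T)) (just v)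
extEdges-closedExcept closed T∩B {nothing} {just z} z∈B (just z∈T) = ⊥-elim (T∩B z∈T z∈B)
extEdges-closedExcept closed T∩B {just x}  {just z} e   (just z∈T) =
  Sum.map just (cong just) (closed e z∈T)

mainTheorem7 : (n : ℕ) (E : Fin n → Fin n → Set)
    (Vh : Subset n) (Eh : Fin n → Fin n → Set)
    → (∀ x y → Eh x y → E x y)
    → (∀ x y → Eh x y → x ∈ Vh × y ∈ Vh)
    → (Wh : Subset n) → Wh ⊆ Vh
    → (∀ u → u ∈ Wh → ∀ x → (E x u ⇔ Eh x u))
    → Nonempty (Vh ─ Wh)
    → (T : Subset n) (v : Fin n) → T ⊆ Wh
    → AlmostTopSCC E T v
    → ((v ∉ (Vh ─ Wh) × (∃ λ b → b ∈ (Vh ─ Wh) × Reach Eh b v))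
    ⊎ (v ∈ (Vh ─ Wh) × 2 ≤ ∣ Vh ─ Wh ∣))
    → DominatorInGh' Eh (Vh ─ Wh) v
mainTheorem7 n E Vh Eh Eh⊆E _ Wh _ sameIn _ T v T⊆Wh
  almostTop@(((_ , allowed , _) , _) , y , y∈T , v→y) cases =
  dominatorInExt , dominatorInGh cases
  where
  closed : ClosedExcept Eh (_∈ T) v
  closed = almostTopSCC⇒closedExcept almostTop Eh⊆E
  T∩B : ∀ {t} → t ∈ T → t ∉ Vh ─ Wh
  T∩B t∈T = x∈q⇒x∉p─q Vh Wh (T⊆Wh t∈T)
  v→ₕy : Eh v y
  v→ₕy = Equivalence.to (sameIn y (T⊆Wh y∈T) v) v→y
  y≢v : y ≢ v
  y≢v = allowed y y∈T

  Hypothesis : Set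
  Hypothesis = (v ∉ (Vh ─ Wh) × (∃ λ b → b ∈ (Vh ─ Wh) × Reach Eh b v))
             ⊎ (v ∈ (Vh ─ Wh) × 2 ≤ ∣ Vh ─ Wh ∣)

  root⇝v : Hypothesis → Path (ExtEdges Eh (Vh ─ Wh)) nothing (just v)
  root⇝v (inj₁ (_ , b , b∈B , b⇝v)) = b∈B ∷ map-Path just id b⇝v
  root⇝v (inj₂ (v∈B , _))           = v∈B ∷ []

  dominatorInExt : 2 ≤ ∣ Vh ─ Wh ∣ → IsVertexDominator (ExtEdges Eh (Vh ─ Wh)) nothing (just v)
  dominatorInExt _ =
    closedExcept⇒isVertexDominator (extEdges-closedExcept closed T∩B) (λ ()) (just y∈T)
      (λ ()) (λ { refl → y≢v refl }) (root⇝v cases ++ (v→ₕy ∷ []))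

  dominatorInGh : Hypothesis → ∀ r → ∣ Vh ─ Wh ∣ ≡ 1 → r ∈ Vh ─ Wh → IsVertexDominator Eh r v
  dominatorInGh (inj₂ (_ , 2≤∣B∣)) r ∣B∣≡1 _ with s≤s () ← subst (2 ≤_) ∣B∣≡1 2≤∣B∣
  dominatorInGh (inj₁ (v∉B , b , b∈B , b⇝v)) r ∣B∣≡1 r∈B
    with refl ← ∣p∣≡1⇒x∈p∧y∈p⇒x≡y (Vh ─ Wh) ∣B∣≡1 b∈B r∈B =
    closedExcept⇒isVertexDominator closed (λ b∈T → T∩B b∈T b∈B) y∈T
      (λ { refl → v∉B b∈B }) y≢v (b⇝v ++ (v→ₕy ∷ []))
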